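{- For every $n\ge1$, Han's map $H\colon S_n\to S_n$ has exactly $2^{n-1}$ fixed points.
   Context: $S_n$ is the set of permutations of $[n]$ in one-line notation. For $x\in[n]$ and a permutation $\sigma=\sigma_1\cdots\sigma_{n-1}$ of $[n]\setminus\{x\}$, define $C^x(\sigma)=\tau_1\cdots\tau_{n-1}\in S_{n-1}$ with $\tau_i=\sigma_i-x+n$ if $\sigma_i<x$ and $\tau_i=\sigma_i-x$ if $\sigma_i>x$, and $C_x(\sigma)=\nu_1\cdots\nu_{n-1}\in S_{n-1}$ with $\nu_i=\sigma_i$ if $\sigma_i<x$ and $\nu_i=\sigma_i-1$ if $\sigma_i>x$. Han's map is defined by $H(1)=1$ and, for $n>1$, $H(\sigma)=C_{\sigma_n}^{ -1}\big(H(C^{\sigma_n}(\sigma_1\cdots\sigma_{n-1}))\big)\cdot\sigma_n$ (concatenation). -}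

module Defs where

open import Data.Nat using (ℕ; zero; suc; _+_; _∸_; _<ᵇ_)
open import Data.Bool using (if_then_else_)
open import Data.List using (List; []; _∷_; map; length; applyUpTo; unsnoc; _++_; [_])
open import Data.Maybe using (Maybe; just; nothing)
open import Data.Product using (_×_; _,_)
open import Data.List.Relation.Binary.Permutation.Propositional using (_↭_)
open import Relation.Binary.PropositionalEquality using (_≡_)

range : ℕ → List ℕ
range n = applyUpTo suc n

-- σ ∈ S_n (one-line notation): σ is a rearrangement of 1 2 ... n
IsPerm : ℕ → List ℕ → Set
IsPerm n σ = σ ↭ range n

-- C^x(σ) for σ a permutation of [n] \ {x}, where n = length σ + 1;
-- entry s ↦ s - x + n if s < x (computed as (s + n) ∸ x), s - x if s > x
CupEntry : ℕ → ℕ → ℕ → ℕ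
CupEntry n x s = if s <ᵇ x then (s + n) ∸ x else s ∸ x

Cᵘ : ℕ → List ℕ → List ℕ
Cᵘ x σ = map (CupEntry (suc (length σ)) x) σ

Cₗ⁻¹ : ℕ → List ℕ → List ℕ
Cₗ⁻¹ x ν = map (λ v → if v <ᵇ x then v else suc v) ν

Hfuel : ℕ → List ℕ → List ℕ
Hfuel zero    σ = σ
Hfuel (suc k) σ with unsnoc σ
... | nothing       = []
... | just (τ , x)  = Cₗ⁻¹ x (Hfuel k (Cᵘ x τ)) ++ [ x ]

H : List ℕ → List ℕ
H σ = Hfuel (length σ) σ

module Submission where

-- H(τ y x) ends in C_x^{-1}(C^x(y)) x, so at a fixed point the entry y is fixed by
-- v ↦ C_x^{-1}(C^x(v)), a cyclic shift by -x followed by a shift by 1 above x; this forces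
-- x = n or x = 1. For x = n both C^n and C_n^{-1} act trivially on τ, and for x = 1 we have
-- τ = π + 1 with C^1(τ) = π; either way σ is fixed iff the shorter permutation is. So the
-- fixed points of S_n arise from those of S_(n-1) by appending n, or by adding 1 and appending 1.

open import Defs
open import Data.Nat using (ℕ; zero; suc; _+_; _∸_; _^_; _≤_; _<_; _<ᵇ_; z≤n; s≤s)
open import Data.Nat.Properties
open import Data.Bool using (true; false; if_then_else_)
open import Data.Sum as Sum using (_⊎_; inj₁; inj₂)
open import Data.Empty using (⊥)
open import Data.Product using (Σ; ∃; _×_; _,_; proj₁)
open import Data.List using (List; []; _∷_; length; map; _++_; [_]; _∷ʳ_; initLast; _∷ʳ′_)
open import Data.List.Properties
  using (length-++; length-map; length-applyUpTo; map-id; map-∘; map-++; map-injective;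
         map-id-local; map-cong-local; applyUpTo-∷ʳ; map-applyUpTo; ∷ʳ-injectiveˡ; ∷ʳ-injectiveʳ)
open import Data.List.Relation.Unary.All as All using (All; []; _∷_)
import Data.List.Relation.Unary.All.Properties as All
open import Data.List.Relation.Unary.Any using (here)
open import Data.List.Relation.Unary.Unique.Propositional using (Unique)
import Data.List.Relation.Unary.Unique.Propositional.Properties as Unique
import Data.List.Relation.Unary.AllPairs as AllPairs
open import Data.List.Membership.Propositional using (_∈_)
open import Data.List.Membership.Propositional.Properties using (∈-applyUpTo⁻; ∈-map⁺; ∈-map⁻; ∈-++⁺ˡ; ∈-++⁺ʳ)
open import Data.List.Relation.Binary.Permutation.Propositional using (_↭_; prep; ↭-refl; ↭-sym; ↭-trans; ↭-reflexive)
open import Data.List.Relation.Binary.Permutation.Propositional.Properties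
  using (∈-resp-↭; ↭-length; ↭-singleton-inv; drop-∷; ++⁺ʳ; ∷↭∷ʳ; map⁺; ↭-map-inv)
open import Function using (_∘_; _⇔_; mk⇔; Equivalence)
open import Relation.Nullary.Reflects using (ofʸ; ofⁿ)
open import Relation.Nullary.Negation using (contradiction)
open import Relation.Binary.PropositionalEquality
  using (_≡_; refl; sym; trans; cong; cong₂; subst; module ≡-Reasoning)
open ≡-Reasoning

initLast-∷ʳ : ∀ (xs : List ℕ) x → initLast (xs ∷ʳ x) ≡ xs ∷ʳ′ x
initLast-∷ʳ []       x = refl
initLast-∷ʳ (y ∷ xs) x rewrite initLast-∷ʳ xs x = refl

Hfuel-∷ʳ : ∀ k τ x → Hfuel (suc k) (τ ∷ʳ x) ≡ Cₗ⁻¹ x (Hfuel k (Cᵘ x τ)) ∷ʳ x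
Hfuel-∷ʳ k τ x rewrite initLast-∷ʳ τ x = refl

length-∷ʳ : ∀ (xs : List ℕ) x → length (xs ∷ʳ x) ≡ suc (length xs)
length-∷ʳ xs x = trans (length-++ xs) (+-comm (length xs) 1)

H-∷ʳ : ∀ τ x → H (τ ∷ʳ x) ≡ Cₗ⁻¹ x (H (Cᵘ x τ)) ∷ʳ x
H-∷ʳ τ x = begin
  Hfuel (length (τ ∷ʳ x)) (τ ∷ʳ x)        ≡⟨ cong (λ k → Hfuel k (τ ∷ʳ x)) (length-∷ʳ τ x) ⟩
  Hfuel (suc (length τ)) (τ ∷ʳ x)         ≡⟨ Hfuel-∷ʳ (length τ) τ x ⟩
  Cₗ⁻¹ x (Hfuel (length τ) (Cᵘ x τ)) ∷ʳ x ≡⟨ cong (λ k → Cₗ⁻¹ x (Hfuel k (Cᵘ x τ)) ∷ʳ x) (length-map _ τ) ⟨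
  Cₗ⁻¹ x (H (Cᵘ x τ)) ∷ʳ x                ∎

punchIn : ℕ → ℕ → ℕ
punchIn x v = if v <ᵇ x then v else suc v

punchIn-< : ∀ {x v} → v < x → punchIn x v ≡ v
punchIn-< {x} {v} v<x with v <ᵇ x | <ᵇ-reflects-< v x
... | true  | _       = refl
... | false | ofⁿ v≮x = contradiction v<x v≮x

punchIn-≥ : ∀ {x v} → x ≤ v → punchIn x v ≡ suc v
punchIn-≥ {x} {v} x≤v with v <ᵇ x | <ᵇ-reflects-< v x
... | true  | ofʸ v<x = contradiction x≤v (<⇒≱ v<x)
... | false | _       = refl

punchIn-injective : ∀ x {u v} → punchIn x u ≡ punchIn x v → u ≡ v
punchIn-injective x {u} {v} eq with u <ᵇ x | <ᵇ-reflects-< u x | v <ᵇ x | <ᵇ-reflects-< v x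
... | true  | _       | true  | _       = eq
... | false | _       | false | _       = suc-injective eq
... | true  | ofʸ u<x | false | ofⁿ v≮x = contradiction (<-trans (n<1+n v) (subst (_< x) eq u<x)) v≮x
... | false | ofⁿ u≮x | true  | ofʸ v<x = contradiction (<-trans (n<1+n u) (subst (_< x) (sym eq) v<x)) u≮x

Cₗ⁻¹-injective : ∀ x {ν ν′} → Cₗ⁻¹ x ν ≡ Cₗ⁻¹ x ν′ → ν ≡ ν′
Cₗ⁻¹-injective x = map-injective (punchIn-injective x)

CupEntry-< : ∀ {N x v} → v < x → CupEntry N x v ≡ (v + N) ∸ x
CupEntry-< {N} {x} {v} v<x with v <ᵇ x | <ᵇ-reflects-< v x
... | true  | _       = refl
... | false | ofⁿ v≮x = contradiction v<x v≮x

punchIn∘CupEntry-fixed : ∀ {N x} y → 1 ≤ x → x ≤ N →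
                         punchIn x (CupEntry N x y) ≡ y → x ≡ N ⊎ x ≡ 1
punchIn∘CupEntry-fixed {N} {x} y 1≤x x≤N eq with y <ᵇ x | <ᵇ-reflects-< y x
... | true | ofʸ y<x with (y + N) ∸ x <ᵇ x | <ᵇ-reflects-< ((y + N) ∸ x) x
...   | true  | _ = inj₁ (sym (+-cancelˡ-≡ y N x (begin
        y + N           ≡⟨ m∸n+n≡m (≤-trans x≤N (m≤n+m N y)) ⟨
        (y + N) ∸ x + x ≡⟨ cong (_+ x) eq ⟩
        y + x           ∎)))
...   | false | _ = contradiction (≤-trans (≤-reflexive eq) y≤c) (n≮n ((y + N) ∸ x))
  where
  y≤c : y ≤ (y + N) ∸ x
  y≤c = ≤-trans (≤-reflexive (sym (m+n∸n≡m y x))) (∸-monoˡ-≤ x (+-monoʳ-≤ y x≤N))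
punchIn∘CupEntry-fixed {N} {x} y 1≤x x≤N eq | false | ofⁿ y≮x with y ∸ x <ᵇ x | <ᵇ-reflects-< (y ∸ x) x
...   | true  | _ = contradiction (+-cancelˡ-≡ y 0 x (begin
        y + 0     ≡⟨ +-identityʳ y ⟩
        y         ≡⟨ m∸n+n≡m (≮⇒≥ y≮x) ⟨
        y ∸ x + x ≡⟨ cong (_+ x) eq ⟩
        y + x     ∎)) (<⇒≢ 1≤x)
...   | false | _ = inj₂ (+-cancelˡ-≡ (y ∸ x) x 1 (begin
        y ∸ x + x   ≡⟨ m∸n+n≡m (≮⇒≥ y≮x) ⟩
        y           ≡⟨ eq ⟨
        suc (y ∸ x) ≡⟨ +-comm 1 (y ∸ x) ⟩
        y ∸ x + 1   ∎))

∈-range⁻ : ∀ n {v} → v ∈ range n → 1 ≤ v × v ≤ n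
∈-range⁻ n v∈ with ∈-applyUpTo⁻ suc v∈
... | i , i<n , refl = s≤s z≤n , i<n

IsPerm⇒bounded : ∀ {n σ} → IsPerm n σ → All (λ v → 1 ≤ v × v ≤ n) σ
IsPerm⇒bounded {n} p = All.tabulate (λ v∈ → ∈-range⁻ n (∈-resp-↭ p v∈))

range-∷ʳ : ∀ k → range (suc k) ≡ range k ∷ʳ suc k
range-∷ʳ k = sym (applyUpTo-∷ʳ suc k)

range-suc : ∀ k → range (suc k) ≡ 1 ∷ map suc (range k)
range-suc k = cong (1 ∷_) (sym (map-applyUpTo suc suc k))

IsPerm-top⁺ : ∀ {k τ} → IsPerm k τ → IsPerm (suc k) (τ ∷ʳ suc k)
IsPerm-top⁺ {k} p = ↭-trans (++⁺ʳ [ suc k ] p) (↭-reflexive (sym (range-∷ʳ k)))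

IsPerm-top⁻ : ∀ {k τ} → IsPerm (suc k) (τ ∷ʳ suc k) → IsPerm k τ
IsPerm-top⁻ {k} {τ} p = drop-∷ (↭-trans (∷↭∷ʳ (suc k) τ) (↭-trans p
  (↭-trans (↭-reflexive (range-∷ʳ k)) (↭-sym (∷↭∷ʳ (suc k) (range k))))))

IsPerm-bottom⁺ : ∀ {k π} → IsPerm k π → IsPerm (suc k) (map suc π ∷ʳ 1)
IsPerm-bottom⁺ {k} {π} p = ↭-trans (↭-sym (∷↭∷ʳ 1 (map suc π)))
  (↭-trans (prep 1 (map⁺ suc p)) (↭-reflexive (sym (range-suc k))))

IsPerm-bottom⁻ : ∀ {k τ} → IsPerm (suc k) (τ ∷ʳ 1) → ∃ λ π → τ ≡ map suc π × IsPerm k π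
IsPerm-bottom⁻ {k} {τ} p with ↭-map-inv suc (↭-sym τ↭)
  where
  τ↭ : τ ↭ map suc (range k)
  τ↭ = drop-∷ (↭-trans (∷↭∷ʳ 1 τ) (↭-trans p (↭-reflexive (range-suc k))))
... | π , τ≡ , q = π , τ≡ , ↭-sym q

Cᵘ-top : ∀ {k τ} → IsPerm k τ → Cᵘ (suc k) τ ≡ τ
Cᵘ-top {k} {τ} p rewrite trans (↭-length p) (length-applyUpTo suc k) =
  map-id-local (All.map (λ (_ , v≤k) → trans (CupEntry-< (s≤s v≤k)) (m+n∸n≡m _ (suc k))) (IsPerm⇒bounded p))

Cₗ⁻¹-top : ∀ {k τ} → IsPerm k τ → Cₗ⁻¹ (suc k) τ ≡ τ
Cₗ⁻¹-top p = map-id-local (All.map (λ (_ , v≤k) → punchIn-< (s≤s v≤k)) (IsPerm⇒bounded p))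

Cᵘ-bottom : ∀ π → Cᵘ 1 (map suc π) ≡ π
Cᵘ-bottom π = trans (sym (map-∘ π)) (map-id π)

Cₗ⁻¹-bottom : ∀ {k π} → IsPerm k π → Cₗ⁻¹ 1 π ≡ map suc π
Cₗ⁻¹-bottom p = map-cong-local (All.map (λ (1≤v , _) → punchIn-≥ 1≤v) (IsPerm⇒bounded p))

HanFixed : ℕ → List ℕ → Set
HanFixed n σ = IsPerm n σ × H σ ≡ σ

H-∷ʳ-fixed⇔ : ∀ {x ρ π} → Cᵘ x ρ ≡ π → Cₗ⁻¹ x π ≡ ρ → (H (ρ ∷ʳ x) ≡ ρ ∷ʳ x) ⇔ (H π ≡ π)
H-∷ʳ-fixed⇔ {x} {ρ} {π} Cᵘρ≡π Cₗ⁻¹π≡ρ = mk⇔ to from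
  where
  to : H (ρ ∷ʳ x) ≡ ρ ∷ʳ x → H π ≡ π
  to h = Cₗ⁻¹-injective x (begin
    Cₗ⁻¹ x (H π)        ≡⟨ cong (Cₗ⁻¹ x ∘ H) Cᵘρ≡π ⟨
    Cₗ⁻¹ x (H (Cᵘ x ρ)) ≡⟨ ∷ʳ-injectiveˡ _ ρ (trans (sym (H-∷ʳ ρ x)) h) ⟩
    ρ                   ≡⟨ Cₗ⁻¹π≡ρ ⟨
    Cₗ⁻¹ x π            ∎)
  from : H π ≡ π → H (ρ ∷ʳ x) ≡ ρ ∷ʳ x
  from h = begin
    H (ρ ∷ʳ x)               ≡⟨ H-∷ʳ ρ x ⟩
    Cₗ⁻¹ x (H (Cᵘ x ρ)) ∷ʳ x ≡⟨ cong (λ σ → Cₗ⁻¹ x (H σ) ∷ʳ x) Cᵘρ≡π ⟩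
    Cₗ⁻¹ x (H π) ∷ʳ x        ≡⟨ cong (λ σ → Cₗ⁻¹ x σ ∷ʳ x) h ⟩
    Cₗ⁻¹ x π ∷ʳ x            ≡⟨ cong (_∷ʳ x) Cₗ⁻¹π≡ρ ⟩
    ρ ∷ʳ x                   ∎

HanFixed-top⁺ : ∀ {k τ} → HanFixed k τ → HanFixed (suc k) (τ ∷ʳ suc k)
HanFixed-top⁺ (p , h) = IsPerm-top⁺ p , Equivalence.from (H-∷ʳ-fixed⇔ (Cᵘ-top p) (Cₗ⁻¹-top p)) h

HanFixed-top⁻ : ∀ {k τ} → HanFixed (suc k) (τ ∷ʳ suc k) → HanFixed k τ
HanFixed-top⁻ {k} {τ} (p , h) = q , Equivalence.to (H-∷ʳ-fixed⇔ (Cᵘ-top q) (Cₗ⁻¹-top q)) h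
  where
  q : IsPerm k τ
  q = IsPerm-top⁻ p

HanFixed-bottom⁺ : ∀ {k π} → HanFixed k π → HanFixed (suc k) (map suc π ∷ʳ 1)
HanFixed-bottom⁺ {π = π} (p , h) =
  IsPerm-bottom⁺ p , Equivalence.from (H-∷ʳ-fixed⇔ (Cᵘ-bottom π) (Cₗ⁻¹-bottom p)) h

HanFixed-bottom⁻ : ∀ {k τ} → HanFixed (suc k) (τ ∷ʳ 1) → ∃ λ π → τ ≡ map suc π × HanFixed k π
HanFixed-bottom⁻ (p , h) with IsPerm-bottom⁻ p
... | π , refl , q = π , refl , q , Equivalence.to (H-∷ʳ-fixed⇔ (Cᵘ-bottom π) (Cₗ⁻¹-bottom q)) h

H-fixed-last : ∀ τ y x → H (τ ∷ʳ y ∷ʳ x) ≡ τ ∷ʳ y ∷ʳ x →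
               punchIn x (CupEntry (suc (length (τ ∷ʳ y))) x y) ≡ y
H-fixed-last τ y x h = ∷ʳ-injectiveʳ (Cₗ⁻¹ x ρ) τ (begin
  Cₗ⁻¹ x ρ ∷ʳ punchIn x (c y)  ≡⟨ map-++ (punchIn x) ρ [ c y ] ⟨
  Cₗ⁻¹ x (ρ ∷ʳ c y)            ≡⟨ cong (Cₗ⁻¹ x) (H-∷ʳ (map c τ) (c y)) ⟨
  Cₗ⁻¹ x (H (map c τ ∷ʳ c y))  ≡⟨ cong (Cₗ⁻¹ x ∘ H) (map-++ c τ [ y ]) ⟨
  Cₗ⁻¹ x (H (Cᵘ x (τ ∷ʳ y)))   ≡⟨ ∷ʳ-injectiveˡ _ _ (trans (sym (H-∷ʳ (τ ∷ʳ y) x)) h) ⟩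
  τ ∷ʳ y                       ∎)
  where
  c : ℕ → ℕ
  c = CupEntry (suc (length (τ ∷ʳ y))) x
  ρ : List ℕ
  ρ = Cₗ⁻¹ (c y) (H (Cᵘ (c y) (map c τ)))

length-init : ∀ {n τ x} → IsPerm (suc n) (τ ∷ʳ x) → length τ ≡ n
length-init {n} {τ} {x} p =
  suc-injective (trans (sym (length-∷ʳ τ x)) (trans (↭-length p) (length-applyUpTo suc (suc n))))

HanFixed-last : ∀ {m τ x} → HanFixed (suc (suc m)) (τ ∷ʳ x) → x ≡ suc (suc m) ⊎ x ≡ 1
HanFixed-last {m} {τ} {x} (p , h)
  with initLast τ | length-init p | ∈-range⁻ (suc (suc m)) (∈-resp-↭ p (∈-++⁺ʳ τ (here refl)))
... | []       | ()  | _
... | τ′ ∷ʳ′ y | len | 1≤x , x≤N =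
  Sum.map₁ (λ x≡ → trans x≡ (cong suc len))
    (punchIn∘CupEntry-fixed y 1≤x (subst (λ n → x ≤ suc n) (sym len) x≤N) (H-fixed-last τ′ y x h))

shiftAppendOne : List ℕ → List ℕ
shiftAppendOne π = map suc π ∷ʳ 1

-- fixedPoints m enumerates the fixed points in S_(m+1).
fixedPoints : ℕ → List (List ℕ)
fixedPoints zero    = [ [ 1 ] ]
fixedPoints (suc m) = map (_∷ʳ suc (suc m)) (fixedPoints m) ++ map shiftAppendOne (fixedPoints m)

fixedPoints-sound : ∀ m → All (HanFixed (suc m)) (fixedPoints m)
fixedPoints-sound zero    = (↭-refl , refl) ∷ []
fixedPoints-sound (suc m) =
  All.++⁺ (All.map⁺ (All.map HanFixed-top⁺ ih)) (All.map⁺ (All.map HanFixed-bottom⁺ ih))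
  where
  ih : All (HanFixed (suc m)) (fixedPoints m)
  ih = fixedPoints-sound m

fixedPoints-complete : ∀ m {σ} → HanFixed (suc m) σ → σ ∈ fixedPoints m
fixedPoints-complete zero (p , _) rewrite ↭-singleton-inv p = here refl
fixedPoints-complete (suc m) {σ} fσ with initLast σ
... | [] with () ← ↭-length (proj₁ fσ)
... | τ ∷ʳ′ x with HanFixed-last fσ
...   | inj₁ refl = ∈-++⁺ˡ (∈-map⁺ (_∷ʳ suc (suc m)) (fixedPoints-complete m (HanFixed-top⁻ fσ)))
...   | inj₂ refl with HanFixed-bottom⁻ fσ
...     | π , refl , fπ = ∈-++⁺ʳ _ (∈-map⁺ shiftAppendOne (fixedPoints-complete m fπ))

length-fixedPoints : ∀ m → length (fixedPoints m) ≡ 2 ^ m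
length-fixedPoints zero    = refl
length-fixedPoints (suc m) = begin
  length (map top L ++ map shiftAppendOne L)        ≡⟨ length-++ (map top L) ⟩
  length (map top L) + length (map shiftAppendOne L) ≡⟨ cong₂ _+_ (length-map top L) (length-map shiftAppendOne L) ⟩
  length L + length L                       ≡⟨ cong (λ n → n + n) (length-fixedPoints m) ⟩
  2 ^ m + 2 ^ m                             ≡⟨ cong (2 ^ m +_) (+-identityʳ (2 ^ m)) ⟨
  2 ^ suc m                                 ∎
  where
  L : List (List ℕ)
  L = fixedPoints m
  top : List ℕ → List ℕ
  top = _∷ʳ suc (suc m)

fixedPoints-unique : ∀ m → Unique (fixedPoints m)
fixedPoints-unique zero    = [] AllPairs.∷ AllPairs.[]
fixedPoints-unique (suc m) =
  Unique.++⁺ (Unique.map⁺ (λ {ρ} {ρ′} → ∷ʳ-injectiveˡ ρ ρ′) ih)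
             (Unique.map⁺ (λ {π} {π′} → map-injective suc-injective ∘ ∷ʳ-injectiveˡ (map suc π) (map suc π′))
                          ih)
             disjoint
  where
  ih : Unique (fixedPoints m)
  ih = fixedPoints-unique m
  disjoint : ∀ {σ} → σ ∈ map (_∷ʳ suc (suc m)) (fixedPoints m) × σ ∈ map shiftAppendOne (fixedPoints m) → ⊥
  disjoint (i , j) with ∈-map⁻ _ i | ∈-map⁻ _ j
  ... | ρ , _ , refl | π , _ , eq with () ← ∷ʳ-injectiveʳ ρ (map suc π) eq

corollary3p3 : (n : ℕ) → 1 ≤ n →
    Σ (List (List ℕ)) λ L →
      length L ≡ 2 ^ (n ∸ 1) × Unique L
      × All (λ σ → IsPerm n σ × H σ ≡ σ) L
      × ((σ : List ℕ) → IsPerm n σ → H σ ≡ σ → σ ∈ L)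
corollary3p3 (suc m) _ =
  fixedPoints m , length-fixedPoints m , fixedPoints-unique m , fixedPoints-sound m ,
  λ σ p h → fixedPoints-complete m (p , h)
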